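{- Let $\langle \mathsf{E}, \mathsf{po}, \mathsf{mo}\rangle$ be a partial 1-Writer execution graph in which $\mathsf{mo}$ agrees with $\mathsf{po}$, and let $\mathsf{rf}_1$ and $\mathsf{rf}_2$ be two reads-from relations over it. (1) If $\mathsf{rf}_1 \sqsubseteq \mathsf{rf}_2$ and $\mathsf{po}\cup\mathsf{rf}_1$ contains a cycle, then $\mathsf{po}\cup\mathsf{rf}_2$ contains a cycle. (2) If both $\mathsf{rf}_1$ and $\mathsf{rf}_2$ satisfy weak-read-coherence, then $\min(\mathsf{rf}_1,\mathsf{rf}_2)$ also satisfies weak-read-coherence.
   Context: Events are reads $\mathtt{r}(x,v)$ or writes $\mathtt{w}(x,v)$ on shared variables $x$ with values $v$, distributed over threads; $\mathsf{po}$ is a strict partial order totally ordering the events of each thread. The graph is 1-Writer: for each variable, all writes on it lie in a single thread. $\mathsf{mo}$ is the union over variables $x$ of strict total orders on writes to $x$, and "agrees with $\mathsf{po}$" means $w_1\,\mathsf{mo}\,w_2$ iff $w_1\,\mathsf{po}\,w_2$ for writes on the same variable. A reads-from relation $\mathsf{rf}$ assigns to every read $r=\mathtt{r}(x,v)$ exactly one write $\mathsf{rf}^{ -1}(r)$ of the form $\mathtt{w}(x,v)$. For reads-from relations, $\mathsf{rf}_1\sqsubseteq\mathsf{rf}_2$ means that for every read $r$, $\mathsf{rf}_1^{ -1}(r)\,\mathsf{po}^*\,\mathsf{rf}_2^{ -1}(r)$ (reflexive-transitive closure of $\mathsf{po}$); $\min(\mathsf{rf}_1,\mathsf{rf}_2)$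 is the reads-from relation assigning to each read $r$ the $\mathsf{po}$-smaller of $\mathsf{rf}_1^{ -1}(r)$ and $\mathsf{rf}_2^{ -1}(r)$ (these lie in the same writer thread). Given $\mathsf{rf}$, let $\mathsf{hb}=(\mathsf{po}\cup\mathsf{rf})^+$; $\mathsf{rf}$ satisfies weak-read-coherence if there is no read $r$ on a variable $x$ and writes $w,w'$ on $x$ with $w\,\mathsf{rf}\,r$, $w\,\mathsf{hb}\,w'$ and $w'\,\mathsf{hb}\,r$. -}

module Defs where

open import Data.Product using (Σ; ∃; ∃-syntax; _×_; _,_)
open import Data.Sum using (_⊎_)
open import Relation.Nullary using (¬_)
open import Relation.Binary.Core using (Rel)
open import Relation.Binary.PropositionalEquality using (_≡_; _≢_)
open import Relation.Binary.Construct.Closure.Transitive using (TransClosure)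
open import Relation.Binary.Construct.Closure.ReflexiveTransitive using (Star)

data Kind : Set where
  R W : Kind

record ExecGraph : Set₁ where
  field
    Event  : Set
    Thread : Set
    Var    : Set
    Val    : Set
    tid    : Event → Thread
    kind   : Event → Kind
    var    : Event → Var
    val    : Event → Val
    po       : Rel Event _
    po-irrefl : ∀ {a} → ¬ po a a
    po-trans  : ∀ {a b c} → po a b → po b c → po a c
    po-total  : ∀ {a b} → tid a ≡ tid b → a ≢ b → po a b ⊎ po b a
    oneWriter : ∀ {w w'} → kind w ≡ W → kind w' ≡ W → var w ≡ var w' → tid w ≡ tid w'
    mo        : Rel Event _
    mo-writes : ∀ {a b} → mo a b → kind a ≡ W × kind b ≡ W × var a ≡ var b
    mo-irrefl : ∀ {a} → ¬ mo a a
    mo-trans  : ∀ {a b c} → mo a b → mo b c → mo a c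
    mo-total  : ∀ {a b} → kind a ≡ W → kind b ≡ W → var a ≡ var b → a ≢ b → mo a b ⊎ mo b a

module _ (G : ExecGraph) where
  open ExecGraph G

  IsRead IsWrite : Event → Set
  IsRead e  = kind e ≡ R
  IsWrite e = kind e ≡ W

  MoAgreesWithPo : Set
  MoAgreesWithPo = ∀ {w₁ w₂} → IsWrite w₁ → IsWrite w₂ → var w₁ ≡ var w₂ →
                   (mo w₁ w₂ → po w₁ w₂) × (po w₁ w₂ → mo w₁ w₂)

  -- reads-from relation: each read r = r(x,v) is assigned exactly one write
  -- src r = rf⁻¹(r) of the form w(x,v).  (src is irrelevant on non-reads.)
  record ReadsFrom : Set where
    field
      src    : Event → Event
      src-ok : ∀ r → IsRead r → IsWrite (src r) × var (src r) ≡ var r × val (src r) ≡ val r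

  open ReadsFrom public

  RfEdge : ReadsFrom → Rel Event _
  RfEdge rf w r = IsRead r × src rf r ≡ w

  PoStar : Rel Event _
  PoStar = Star po

  _⊑_ : ReadsFrom → ReadsFrom → Set
  rf₁ ⊑ rf₂ = ∀ r → IsRead r → PoStar (src rf₁ r) (src rf₂ r)

  IsMin : ReadsFrom → ReadsFrom → ReadsFrom → Set
  IsMin rf rf₁ rf₂ = ∀ r → IsRead r →
    (src rf r ≡ src rf₁ r × PoStar (src rf₁ r) (src rf₂ r)) ⊎
    (src rf r ≡ src rf₂ r × PoStar (src rf₂ r) (src rf₁ r))

  PoRf : ReadsFrom → Rel Event _
  PoRf rf a b = po a b ⊎ RfEdge rf a b

  HasCycle : ReadsFrom → Set
  HasCycle rf = ∃[ e ] TransClosure (PoRf rf) e e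

  HB : ReadsFrom → Rel Event _
  HB rf = TransClosure (PoRf rf)

  WeakReadCoherent : ReadsFrom → Set
  WeakReadCoherent rf = ¬ (∃[ r ] ∃[ w ] ∃[ w' ]
    (IsRead r × IsWrite w' × var w' ≡ var r ×
     RfEdge rf w r × HB rf w w' × HB rf w' r))

{-# OPTIONS --safe #-}
module Submission where

-- Moving the source of every read po-later can only add happens-before edges:
-- an edge w rf₁ r is recovered as the path w po* w' rf₂ r.  Hence cycles
-- survive when passing from rf₁ to rf₂ ⊒ rf₁.  The relation min(rf₁, rf₂) lies
-- below both rf₁ and rf₂ and, at each read, coincides with one of them, so a
-- weak-read-coherence violation of min at that read is one of rf₁ or of rf₂.

open import Defs
open import Data.Product using (_×_; _,_; ∃-syntax)
open import Data.Sum using (inj₁; inj₂)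
open import Level using (Level)
open import Relation.Binary.Core using (Rel; _⇒_)
open import Relation.Binary.PropositionalEquality using (_≡_; refl; sym; trans)
open import Relation.Binary.Construct.Closure.Transitive using (TransClosure; [_]; _∷_; _++_)
open import Relation.Binary.Construct.Closure.ReflexiveTransitive using (Star; ε; _◅_)

module _ {a ℓ₁ ℓ₂ : Level} {A : Set a} {R : Rel A ℓ₁} {S : Rel A ℓ₂} where

  ⁺-concatMap : R ⇒ TransClosure S → TransClosure R ⇒ TransClosure S
  ⁺-concatMap f [ x∼y ]       = f x∼y
  ⁺-concatMap f (x∼y ∷ y∼⁺z) = f x∼y ++ ⁺-concatMap f y∼⁺z

  ⋆-prepend⁺ : R ⇒ S → ∀ {x y z} → Star R x y → TransClosure S y z → TransClosure S x z
  ⋆-prepend⁺ f ε          y∼⁺z = y∼⁺z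
  ⋆-prepend⁺ f (x∼y ◅ xs) y∼⁺z = f x∼y ∷ ⋆-prepend⁺ f xs y∼⁺z

module _ (G : ExecGraph) where
  open ExecGraph G

  -- WeakReadCoherent G rf unfolds to ¬ ∃[ r ] IncoherentRead rf r.
  IncoherentRead : ReadsFrom G → Event → Set
  IncoherentRead rf r = ∃[ w ] ∃[ w' ]
    (IsRead G r × IsWrite G w' × var w' ≡ var r ×
     RfEdge G rf w r × HB G rf w w' × HB G rf w' r)

  module _ {rf rf' : ReadsFrom G} (rf⊑rf' : _⊑_ G rf rf') where

    PoRf⇒HB : PoRf G rf ⇒ HB G rf'
    PoRf⇒HB (inj₁ a-po-b)         = [ inj₁ a-po-b ]
    PoRf⇒HB (inj₂ (read-b , refl)) = ⋆-prepend⁺ inj₁ (rf⊑rf' _ read-b) [ inj₂ (read-b , refl) ]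

    HB-mono : HB G rf ⇒ HB G rf'
    HB-mono = ⁺-concatMap PoRf⇒HB

    HasCycle-mono : HasCycle G rf → HasCycle G rf'
    HasCycle-mono (e , cycle) = e , HB-mono cycle

    IncoherentRead-mono : ∀ {r} → src rf r ≡ src rf' r →
                          IncoherentRead rf r → IncoherentRead rf' r
    IncoherentRead-mono same (w , w' , read-r , write-w' , var≡ , (read-r' , src≡w) , w-hb-w' , w'-hb-r) =
      w , w' , read-r , write-w' , var≡ , (read-r' , trans (sym same) src≡w) ,
      HB-mono w-hb-w' , HB-mono w'-hb-r

  module _ {rf rf₁ rf₂ : ReadsFrom G} (isMin : IsMin G rf rf₁ rf₂) where

    private
      PoStar-≡ : ∀ {a b} c → a ≡ b → PoStar G b c → PoStar G a c
      PoStar-≡ c refl b-po*-c = b-po*-c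

    min-⊑ˡ : _⊑_ G rf rf₁
    min-⊑ˡ r read-r with isMin r read-r
    ... | inj₁ (same , _)   = PoStar-≡ (src rf₁ r) same ε
    ... | inj₂ (same , 2≤1) = PoStar-≡ (src rf₁ r) same 2≤1

    min-⊑ʳ : _⊑_ G rf rf₂
    min-⊑ʳ r read-r with isMin r read-r
    ... | inj₁ (same , 1≤2) = PoStar-≡ (src rf₂ r) same 1≤2
    ... | inj₂ (same , _)   = PoStar-≡ (src rf₂ r) same ε

    WeakReadCoherent-min : WeakReadCoherent G rf₁ → WeakReadCoherent G rf₂ → WeakReadCoherent G rf
    WeakReadCoherent-min coh₁ coh₂ (r , bad@(_ , _ , read-r , _)) with isMin r read-r
    ... | inj₁ (same , _) = coh₁ (r , IncoherentRead-mono {rf} {rf₁} min-⊑ˡ same bad)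
    ... | inj₂ (same , _) = coh₂ (r , IncoherentRead-mono {rf} {rf₂} min-⊑ʳ same bad)

-- Neither part needs mo to agree with po.
lemma3 : (G : ExecGraph) → MoAgreesWithPo G → (rf₁ rf₂ : ReadsFrom G) →
         (_⊑_ G rf₁ rf₂ → HasCycle G rf₁ → HasCycle G rf₂) ×
         (WeakReadCoherent G rf₁ → WeakReadCoherent G rf₂ →
          (rf : ReadsFrom G) → IsMin G rf rf₁ rf₂ → WeakReadCoherent G rf)
lemma3 G _ rf₁ rf₂ =
  (λ rf₁⊑rf₂ → HasCycle-mono G {rf₁} {rf₂} rf₁⊑rf₂) ,
  (λ coh₁ coh₂ rf isMin → WeakReadCoherent-min G {rf} {rf₁} {rf₂} isMin coh₁ coh₂)
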